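{- Let $p \geq 5$ be a prime, let $g$ be an odd integer whose class generates $(\mathbb{Z}/p\mathbb{Z})^\times$, and put $k = (p-1)/\gcd(p-1,12)$, $\ell = \gcd(p-1,12)/2$. Then $\Gamma_2'(p)$ is a normal subgroup of $\Gamma_0(p)$ and $\Gamma_0(p)/\Gamma_2'(p)$ is cyclic of order $2k$.
   Context: $\Gamma_0(p)$ and $\Gamma_1(p)$ are the usual congruence subgroups of $\mathrm{SL}(2,\mathbb{Z})$. $\Gamma_2(p)$ is the subgroup generated by $\Gamma_1(p)$ and all matrices $\begin{pmatrix} a & b \\ c & d\end{pmatrix} \in \Gamma_0(p)$ with $a \equiv g^k \pmod p$. Let $\psi$ be the character of order $2$ of $\mathrm{SL}(2,\mathbb{Z})$ given by $\psi\begin{pmatrix} a&b\\c&d\end{pmatrix} = (-1)^{a+d-1}$ if $c$ is odd and $(-1)^b$ if $c$ is even. If $\ell$ is even (i.e. $p\equiv 1 \pmod 4$), let $\chi$ be the character of $\Gamma_2(p)$ defined by $\chi(\gamma) = (-1)^n$ where $\gamma = \begin{pmatrix} a&b\\c&d\end{pmatrix}$ and $n$ is an integer with $a \equiv g^{nk} \pmod p$ (the unique order-$2$ character of $\Gamma_2(p)$ trivial on $\Gamma_1(p)$). $\Gamma_2'(p)$ is the kernel of $\psi\chi$ on $\Gamma_2(p)$ if $p \equiv 1 \pmod 4$, and the kernel of $\psi$ on $\Gamma_2(p)$ if $p \equiv 3 \pmod 4$. -}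

module Defs where

open import Data.Nat as ℕ using (ℕ; zero; suc; _%_; _≡ᵇ_)
open import Data.Nat.Divisibility as ℕD using ()
open import Data.Integer as ℤ using (ℤ; +_; -_; _-_; ∣_∣; 1ℤ; 0ℤ)
open import Data.Integer.Divisibility using (_∣_)
open import Data.Bool using (Bool; true; false; if_then_else_)
open import Data.Product using (Σ; ∃; _×_; _,_)
open import Data.Sum using (_⊎_)
open import Relation.Binary.PropositionalEquality using (_≡_)

record M : Set where
  constructor mat
  field
    a b c d : ℤ
open M public

_·_ : M → M → M
mat a₁ b₁ c₁ d₁ · mat a₂ b₂ c₂ d₂ =
  mat (a₁ ℤ.* a₂ ℤ.+ b₁ ℤ.* c₂) (a₁ ℤ.* b₂ ℤ.+ b₁ ℤ.* d₂)
      (c₁ ℤ.* a₂ ℤ.+ d₁ ℤ.* c₂) (c₁ ℤ.* b₂ ℤ.+ d₁ ℤ.* d₂)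
infixl 7 _·_

I : M
I = mat 1ℤ 0ℤ 0ℤ 1ℤ

-- inverse of a determinant-one matrix (adjugate)
inv : M → M
inv (mat a b c d) = mat d (- b) (- c) a

_^^_ : M → ℕ → M
γ ^^ zero = I
γ ^^ suc n = γ · (γ ^^ n)

det : M → ℤ
det (mat a b c d) = a ℤ.* d ℤ.- b ℤ.* c

_≡_[mod_] : ℤ → ℤ → ℕ → Set
x ≡ y [mod n ] = (+ n) ∣ (x - y)

SL2 : M → Set
SL2 γ = det γ ≡ 1ℤ

Γ₀ : ℕ → M → Set
Γ₀ p γ = SL2 γ × (c γ ≡ 0ℤ [mod p ])

Γ₁ : ℕ → M → Set
Γ₁ p γ = Γ₀ p γ × (a γ ≡ 1ℤ [mod p ]) × (d γ ≡ 1ℤ [mod p ])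

data Gen (S : M → Set) : M → Set where
  gen : ∀ {γ} → S γ → Gen S γ
  one : Gen S I
  mul : ∀ {γ δ} → Gen S γ → Gen S δ → Gen S (γ · δ)
  inv-closed : ∀ {γ} → Gen S γ → Gen S (inv γ)

Γ₂ : ℕ → ℤ → ℕ → M → Set
Γ₂ p g k = Gen (λ γ → Γ₁ p γ ⊎ (Γ₀ p γ × (a γ ≡ g ℤ.^ k [mod p ])))

sgn : ℤ → ℤ
sgn x = if (∣ x ∣ % 2) ≡ᵇ 0 then 1ℤ else ℤ.-1ℤ

ψ : M → ℤ
ψ (mat a b c d) =
  if (∣ c ∣ % 2) ≡ᵇ 1 then sgn (a ℤ.+ d ℤ.- 1ℤ) else sgn b

-- Γ₂'(p): kernel of ψχ on Γ₂(p) if p ≡ 1 (mod 4), kernel of ψ if p ≡ 3 (mod 4).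
-- χ(γ) = (-1)^n where a ≡ g^(nk) (mod p).
Γ₂′ : ℕ → ℤ → ℕ → M → Set
Γ₂′ p g k γ =
  if (p % 4) ≡ᵇ 1
  then (Γ₂ p g k γ × ∃ λ (n : ℕ) → (a γ ≡ g ℤ.^ (n ℕ.* k) [mod p ])
                                   × (ψ γ ℤ.* sgn (+ n) ≡ 1ℤ))
  else (Γ₂ p g k γ × ψ γ ≡ 1ℤ)

IsOdd : ℤ → Set
IsOdd x = ∣ x ∣ % 2 ≡ 1

Generates : ℕ → ℤ → Set
Generates p g = ∀ (x : ℤ) → ¬′ ((+ p) ∣ x) → ∃ λ (n : ℕ) → x ≡ g ℤ.^ n [mod p ]
  where
  open import Data.Empty using (⊥)
  ¬′ : Set → Set
  ¬′ A = A → ⊥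

IsNormalSubgroupOf : (M → Set) → (M → Set) → Set
IsNormalSubgroupOf H G =
    (∀ γ → H γ → G γ)
  × H I
  × (∀ γ δ → H γ → H δ → H (γ · δ))
  × (∀ γ → H γ → H (inv γ))
  × (∀ γ h → G γ → H h → H (γ · h · inv γ))

QuotientCyclicOfOrder : (M → Set) → (M → Set) → ℕ → Set
QuotientCyclicOfOrder G H n =
  Σ M λ x → G x
    × (∀ γ → G γ → ∃ λ (i : ℕ) → H (inv (x ^^ i) · γ))
    × (∀ (m : ℕ) → (H (x ^^ m) → n ℕD.∣ m) × (n ℕD.∣ m → H (x ^^ m)))

{-# OPTIONS --safe #-}
module Submission where

-- On Γ₀(p) the entry a is multiplicative modulo p, with values in (ℤ/p)ˣ = ⟨g⟩, and ψ is a character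
-- that factors through SL(2, 𝔽₂). So Γ₂(p) consists of the γ ∈ Γ₀(p) with a γ ≡ g^(nk) for some n, and
-- Γ₂′(p) is cut out of it by ψ(γ) = (-1)^(εn), where ε = 1 if p ≡ 1 (mod 4) and ε = 0 otherwise. Since a and
-- ψ are invariant under conjugation, Γ₂′(p) is normal in Γ₀(p). Take x ∈ Γ₀(p) with a x ≡ g and
-- ψ(x) = -(-1)^ε. Every coset of Γ₂′(p) contains a power of x, and xᵐ ∈ Γ₂′(p) forces m ≡ nk (mod 2k) with
-- n even: for ε = 1 because ψ(xᵐ) = 1, for ε = 0 because then k is odd (as 4 ∤ p - 1) and ψ(xᵐ) = (-1)ᵐ.

open import Defs
open import Data.Bool using (true; false; if_then_else_)
open import Data.Fin as Fin using (Fin; toℕ; fromℕ<)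
import Data.Fin.Properties as Finₚ
open import Data.Integer as ℤ using (ℤ; +_; -[1+_]; -_; _-_; ∣_∣; 0ℤ; 1ℤ; -1ℤ; _+_; _*_; _^_; _%ℕ_; _/ℕ_)
open import Data.Integer.DivMod using (a≡a%ℕn+[a/ℕn]*n; n%ℕd<d)
open import Data.Integer.Divisibility using () renaming (_∣_ to _∣ᵤ_)
import Data.Integer.Properties as ℤₚ
open import Data.Integer.Divisibility.Signed as ℤ∣ using (divides)
open import Data.Integer.Tactic.RingSolver using (solve-∀)
open import Data.Nat.Tactic.RingSolver using () renaming (solve-∀ to ℕ-solve-∀)
open import Data.Nat as ℕ using (ℕ; zero; suc; z≤n; s≤s; z<s; NonZero; _%_; _/_; parity)
open import Data.Nat.DivMod using (m≡m%n+[m/n]*n; m%n<n; [m+kn]%n≡m%n)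
import Data.Nat.Divisibility as ℕ∣
open import Data.Nat.GCD using (gcd)
open import Data.Nat.Primality using (Prime; euclidsLemma)
import Data.Nat.Properties as ℕₚ
open import Data.Parity as ℙ using (Parity; 0ℙ; 1ℙ)
import Data.Parity.Properties as ℙₚ
open import Data.Product using (∃; ∃₂; _×_; _,_; proj₁; proj₂)
open import Data.Sum using (_⊎_; inj₁; inj₂; [_,_]′)
open import Function using (_∘_)
open import Function.Bundles using (_⇔_; mk⇔; Equivalence)
open import Relation.Binary using (Setoid; IsEquivalence)
open import Relation.Binary.PropositionalEquality
open import Relation.Unary using (_≐_)
open import Relation.Unary.Properties using (≐-refl; ≐-sym; ≐-trans)
open import Relation.Nullary using (¬_; contradiction; Dec; yes; no; _→-dec_)
open import Relation.Nullary.Decidable using (map′; toWitness)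

-- Congruences of integers

-- Defs' congruence wrapped in a record, so that both sides and the modulus can be inferred.
record _≈_[mod_] (x y : ℤ) (n : ℕ) : Set where
  constructor mk≈
  field congruent : x ≡ y [mod n ]
open _≈_[mod_] public

infix 4 _≈_[mod_]

module _ {n : ℕ} where

  ≈-via : ∀ {x y} e → x - y ≡ e → + n ℤ∣.∣ e → x ≈ y [mod n ]
  ≈-via e eq n∣e = mk≈ (ℤ∣.∣⇒∣ᵤ (subst (+ n ℤ∣.∣_) (sym eq) n∣e))

  ≈⇒∣ : ∀ {x y} → x ≈ y [mod n ] → + n ℤ∣.∣ x - y
  ≈⇒∣ (mk≈ h) = ℤ∣.∣ᵤ⇒∣ h

  ≈-refl : ∀ {x} → x ≈ x [mod n ]
  ≈-refl {x} = ≈-via 0ℤ (ℤₚ.+-inverseʳ x) (divides 0ℤ refl)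

  ≈-reflexive : ∀ {x y} → x ≡ y → x ≈ y [mod n ]
  ≈-reflexive refl = ≈-refl

  ≈-sym : ∀ {x y} → x ≈ y [mod n ] → y ≈ x [mod n ]
  ≈-sym {x} {y} h = ≈-via _ (swap x y) (ℤ∣.∣m⇒∣-m (≈⇒∣ h))
    where
    swap : ∀ x y → y - x ≡ - (x - y)
    swap = solve-∀

  ≈-trans : ∀ {x y z} → x ≈ y [mod n ] → y ≈ z [mod n ] → x ≈ z [mod n ]
  ≈-trans {x} {y} {z} h h′ = ≈-via _ (split x y z) (ℤ∣.∣m∣n⇒∣m+n (≈⇒∣ h) (≈⇒∣ h′))
    where
    split : ∀ x y z → x - z ≡ (x - y) + (y - z)
    split = solve-∀

  ≈-isEquivalence : IsEquivalence (λ x y → x ≈ y [mod n ])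
  ≈-isEquivalence = record { refl = ≈-refl ; sym = ≈-sym ; trans = ≈-trans }

  +-cong : ∀ {x x′ y y′} → x ≈ x′ [mod n ] → y ≈ y′ [mod n ] → x + y ≈ x′ + y′ [mod n ]
  +-cong {x} {x′} {y} {y′} h h′ = ≈-via _ (split x x′ y y′) (ℤ∣.∣m∣n⇒∣m+n (≈⇒∣ h) (≈⇒∣ h′))
    where
    split : ∀ x x′ y y′ → (x + y) - (x′ + y′) ≡ (x - x′) + (y - y′)
    split = solve-∀

  *-cong : ∀ {x x′ y y′} → x ≈ x′ [mod n ] → y ≈ y′ [mod n ] → x * y ≈ x′ * y′ [mod n ]
  *-cong {x} {x′} {y} {y′} h h′ =
    ≈-via _ (split x x′ y y′) (ℤ∣.∣m∣n⇒∣m+n (ℤ∣.∣n⇒∣m*n x (≈⇒∣ h′)) (ℤ∣.∣m⇒∣m*n y′ (≈⇒∣ h)))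
    where
    split : ∀ x x′ y y′ → x * y - x′ * y′ ≡ x * (y - y′) + (x - x′) * y′
    split = solve-∀

  +-congˡ : ∀ x {y y′} → y ≈ y′ [mod n ] → x + y ≈ x + y′ [mod n ]
  +-congˡ x = +-cong (≈-refl {x})

  *-congˡ : ∀ x {y y′} → y ≈ y′ [mod n ] → x * y ≈ x * y′ [mod n ]
  *-congˡ x = *-cong (≈-refl {x})

  *-congʳ : ∀ y {x x′} → x ≈ x′ [mod n ] → x * y ≈ x′ * y [mod n ]
  *-congʳ y h = *-cong h (≈-refl {y})

  -‿cong : ∀ {x x′} → x ≈ x′ [mod n ] → - x ≈ - x′ [mod n ]
  -‿cong {x} {x′} h = ≈-via _ (split x x′) (ℤ∣.∣m⇒∣-m (≈⇒∣ h))
    where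
    split : ∀ x x′ → - x - - x′ ≡ - (x - x′)
    split = solve-∀

  ^-cong : ∀ {x y} m → x ≈ y [mod n ] → x ^ m ≈ y ^ m [mod n ]
  ^-cong zero    h = ≈-refl
  ^-cong (suc m) h = *-cong h (^-cong m h)

  ∣⇒≈0 : ∀ {x} → + n ℤ∣.∣ x → x ≈ 0ℤ [mod n ]
  ∣⇒≈0 {x} = ≈-via x (ℤₚ.+-identityʳ x)

  ≈0⇒∣ : ∀ {x} → x ≈ 0ℤ [mod n ] → + n ℤ∣.∣ x
  ≈0⇒∣ {x} h = subst (+ n ℤ∣.∣_) (ℤₚ.+-identityʳ x) (≈⇒∣ h)

  *n≈0 : ∀ q → q * + n ≈ 0ℤ [mod n ]
  *n≈0 q = ∣⇒≈0 (divides q refl)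

  ≈-weaken : ∀ {d x y} → d ℕ∣.∣ n → x ≈ y [mod n ] → x ≈ y [mod d ]
  ≈-weaken {d} d∣n h = mk≈ (ℤ∣.∣⇒∣ᵤ (ℤ∣.∣-trans (ℤ∣.∣ᵤ⇒∣ {+ d} {+ n} d∣n) (≈⇒∣ h)))

  x-y≈0⇒x≈y : ∀ {x y} → x - y ≈ 0ℤ [mod n ] → x ≈ y [mod n ]
  x-y≈0⇒x≈y h = mk≈ (ℤ∣.∣⇒∣ᵤ (≈0⇒∣ h))

  <-≈⇒≡ : ∀ {r s} → r ℕ.< n → s ℕ.< n → + r ≈ + s [mod n ] → r ≡ s
  <-≈⇒≡ {r} {s} r<n s<n (mk≈ n∣r-s) =
    ℤₚ.+-injective (ℤₚ.i-j≡0⇒i≡j (+ r) (+ s) (ℤₚ.∣i∣≡0⇒i≡0 (small-multiple n∣r-s ∣r-s∣<n)))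
    where
    ∣r-s∣<n : ∣ + r - + s ∣ ℕ.< n
    ∣r-s∣<n = subst (ℕ._< n) (cong ∣_∣ (sym (ℤₚ.m-n≡m⊖n r s)))
                    (ℕₚ.≤-<-trans (ℤₚ.∣m⊝n∣≤m⊔n r s) (ℕₚ.⊔-pres-<m r<n s<n))
    small-multiple : ∀ {m} → n ℕ∣.∣ m → m ℕ.< n → m ≡ 0
    small-multiple {zero}  _   _   = refl
    small-multiple {suc m} n∣m m<n = contradiction n∣m (ℕ∣.>⇒∤ m<n)

≈-setoid : ℕ → Setoid _ _
≈-setoid n = record { isEquivalence = ≈-isEquivalence {n} }

module ≈-Reasoning (n : ℕ) where
  open import Relation.Binary.Reasoning.Setoid (≈-setoid n) public

module _ {n : ℕ} .{{_ : NonZero n}} where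

  ≈-%ℕ : ∀ x → x ≈ + (x %ℕ n) [mod n ]
  ≈-%ℕ x = begin
    x                                ≡⟨ a≡a%ℕn+[a/ℕn]*n x n ⟩
    + (x %ℕ n) + (x /ℕ n) * + n      ≈⟨ +-congˡ (+ (x %ℕ n)) (*n≈0 (x /ℕ n)) ⟩
    + (x %ℕ n) + 0ℤ                  ≡⟨ ℤₚ.+-identityʳ _ ⟩
    + (x %ℕ n)                       ∎
    where open ≈-Reasoning n

  ≈-% : ∀ m → + m ≈ + (m % n) [mod n ]
  ≈-% m = ≈-%ℕ (+ m)

^-reduce : ∀ {n x} d .{{_ : NonZero d}} → x ^ d ≈ 1ℤ [mod n ] → ∀ e → x ^ e ≈ x ^ (e % d) [mod n ]
^-reduce {n} {x} d xᵈ≈1 e = begin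
  x ^ e                                  ≡⟨ cong (x ^_) (m≡m%n+[m/n]*n e d) ⟩
  x ^ (e % d ℕ.+ (e / d) ℕ.* d)          ≡⟨ ℤₚ.^-distribˡ-+-* x (e % d) _ ⟩
  x ^ (e % d) * x ^ ((e / d) ℕ.* d)      ≡⟨ cong (λ i → x ^ (e % d) * x ^ i) (ℕₚ.*-comm (e / d) d) ⟩
  x ^ (e % d) * x ^ (d ℕ.* (e / d))      ≡⟨ cong (x ^ (e % d) *_) (ℤₚ.^-*-assoc x d (e / d)) ⟨
  x ^ (e % d) * (x ^ d) ^ (e / d)        ≈⟨ *-congˡ (x ^ (e % d)) (^-cong (e / d) xᵈ≈1) ⟩
  x ^ (e % d) * 1ℤ ^ (e / d)             ≡⟨ cong (x ^ (e % d) *_) (ℤₚ.^-zeroˡ (e / d)) ⟩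
  x ^ (e % d) * 1ℤ                       ≡⟨ ℤₚ.*-identityʳ _ ⟩
  x ^ (e % d)                            ∎
  where open ≈-Reasoning n

-- Parity and signs

parityℤ : ℤ → Parity
parityℤ x = parity ∣ x ∣

bit : Parity → ℤ
bit 0ℙ = 0ℤ
bit 1ℙ = 1ℤ

bit-injective : ∀ {p q} → bit p ≈ bit q [mod 2 ] → p ≡ q
bit-injective {0ℙ} {0ℙ} _ = refl
bit-injective {1ℙ} {1ℙ} _ = refl
bit-injective {0ℙ} {1ℙ} (mk≈ 2∣1) = contradiction 2∣1 (ℕ∣.>⇒∤ (s≤s (s≤s z≤n)))
bit-injective {1ℙ} {0ℙ} (mk≈ 2∣1) = contradiction 2∣1 (ℕ∣.>⇒∤ (s≤s (s≤s z≤n)))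

≈-bit-parity : ∀ x → x ≈ bit (parityℤ x) [mod 2 ]
≈-bit-parity (+ n)     = ≈-bit-parityℕ n
  where
  ≈-bit-parityℕ : ∀ n → + n ≈ bit (parity n) [mod 2 ]
  ≈-bit-parityℕ 0             = ≈-refl
  ≈-bit-parityℕ 1             = ≈-refl
  ≈-bit-parityℕ (suc (suc n)) = ≈-trans (≈-via (+ 2) (shift (+ n)) (divides 1ℤ refl)) (≈-bit-parityℕ n)
    where
    shift : ∀ y → (+ 2 + y) - y ≡ + 2
    shift = solve-∀
≈-bit-parity -[1+ n ] = ≈-trans (≈-via _ (double (+ suc n)) (divides (- + suc n) refl)) (≈-bit-parity (+ suc n))
  where
  double : ∀ y → - y - y ≡ (- y) * + 2
  double = solve-∀

≈[mod2]⇒parity≡ : ∀ {x y} → x ≈ y [mod 2 ] → parityℤ x ≡ parityℤ y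
≈[mod2]⇒parity≡ {x} {y} h = bit-injective (≈-trans (≈-sym (≈-bit-parity x)) (≈-trans h (≈-bit-parity y)))

bit-+ : ∀ p q → bit p + bit q ≈ bit (p ℙ.+ q) [mod 2 ]
bit-+ 0ℙ 0ℙ = ≈-refl
bit-+ 0ℙ 1ℙ = ≈-refl
bit-+ 1ℙ 0ℙ = ≈-refl
bit-+ 1ℙ 1ℙ = ∣⇒≈0 (divides 1ℤ refl)

bit-* : ∀ p q → bit p * bit q ≡ bit (p ℙ.* q)
bit-* 0ℙ q  = refl
bit-* 1ℙ 0ℙ = refl
bit-* 1ℙ 1ℙ = refl

parityℤ-+ : ∀ x y → parityℤ (x + y) ≡ parityℤ x ℙ.+ parityℤ y
parityℤ-+ x y = bit-injective (begin
  bit (parityℤ (x + y))                    ≈⟨ ≈-bit-parity (x + y) ⟨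
  x + y                                    ≈⟨ +-cong (≈-bit-parity x) (≈-bit-parity y) ⟩
  bit (parityℤ x) + bit (parityℤ y)        ≈⟨ bit-+ (parityℤ x) (parityℤ y) ⟩
  bit (parityℤ x ℙ.+ parityℤ y)            ∎)
  where open ≈-Reasoning 2

parityℤ-* : ∀ x y → parityℤ (x * y) ≡ parityℤ x ℙ.* parityℤ y
parityℤ-* x y = bit-injective (begin
  bit (parityℤ (x * y))                    ≈⟨ ≈-bit-parity (x * y) ⟨
  x * y                                    ≈⟨ *-cong (≈-bit-parity x) (≈-bit-parity y) ⟩
  bit (parityℤ x) * bit (parityℤ y)        ≡⟨ bit-* (parityℤ x) (parityℤ y) ⟩
  bit (parityℤ x ℙ.* parityℤ y)            ∎)
  where open ≈-Reasoning 2

parityℤ-neg : ∀ x → parityℤ (- x) ≡ parityℤ x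
parityℤ-neg x = cong parity (ℤₚ.∣-i∣≡∣i∣ x)

even⇒parity≡0ℙ : ∀ {n} → 2 ℕ∣.∣ n → parity n ≡ 0ℙ
even⇒parity≡0ℙ (ℕ∣.divides q refl) = trans (ℙₚ.*-homo-* q 2) (ℙₚ.*-zeroʳ (parity q))

parity≡0ℙ⇒even : ∀ {n} → parity n ≡ 0ℙ → 2 ℕ∣.∣ n
parity≡0ℙ⇒even {n} pn≡0 = ℤ∣.∣⇒∣ᵤ (≈0⇒∣ (≈-trans (≈-bit-parity (+ n)) (≈-reflexive (cong bit pn≡0))))

-1^_ : Parity → ℤ
-1^ 0ℙ = 1ℤ
-1^ 1ℙ = -1ℤ

-1^-+ : ∀ p q → -1^ (p ℙ.+ q) ≡ -1^ p * -1^ q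
-1^-+ 0ℙ q  = sym (ℤₚ.*-identityˡ (-1^ q))
-1^-+ 1ℙ 0ℙ = refl
-1^-+ 1ℙ 1ℙ = refl

-1^≡1⇒0ℙ : ∀ {p} → -1^ p ≡ 1ℤ → p ≡ 0ℙ
-1^≡1⇒0ℙ {0ℙ} _  = refl
-1^≡1⇒0ℙ {1ℙ} ()

sgn≡-1^parity : ∀ x → sgn x ≡ -1^ (parityℤ x)
sgn≡-1^parity x = sgnℕ ∣ x ∣
  where
  sgnℕ : ∀ n → (if n % 2 ℕ.≡ᵇ 0 then 1ℤ else -1ℤ) ≡ -1^ (parity n)
  sgnℕ 0             = refl
  sgnℕ 1             = refl
  sgnℕ (suc (suc n)) = sgnℕ n

-- 2 × 2 matrices and Γ₀(p)

mat-cong : ∀ {a a′ b b′ c c′ d d′} → a ≡ a′ → b ≡ b′ → c ≡ c′ → d ≡ d′ → mat a b c d ≡ mat a′ b′ c′ d′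
mat-cong refl refl refl refl = refl

·-assoc : ∀ x y z → (x · y) · z ≡ x · (y · z)
·-assoc (mat a₁ b₁ c₁ d₁) (mat a₂ b₂ c₂ d₂) (mat a₃ b₃ c₃ d₃) =
  mat-cong (entry a₁ b₁ a₂ b₂ c₂ d₂ a₃ c₃) (entry a₁ b₁ a₂ b₂ c₂ d₂ b₃ d₃)
           (entry c₁ d₁ a₂ b₂ c₂ d₂ a₃ c₃) (entry c₁ d₁ a₂ b₂ c₂ d₂ b₃ d₃)
  where
  entry : ∀ r₁ r₂ a b c d s₁ s₂ →
          (r₁ * a + r₂ * c) * s₁ + (r₁ * b + r₂ * d) * s₂ ≡ r₁ * (a * s₁ + b * s₂) + r₂ * (c * s₁ + d * s₂)
  entry = solve-∀

·-identityˡ : ∀ x → I · x ≡ x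
·-identityˡ (mat a b c d) = mat-cong (row₁ a c) (row₁ b d) (row₂ a c) (row₂ b d)
  where
  row₁ : ∀ x y → 1ℤ * x + 0ℤ * y ≡ x
  row₁ = solve-∀
  row₂ : ∀ x y → 0ℤ * x + 1ℤ * y ≡ y
  row₂ = solve-∀

·-inverseʳ : ∀ x → SL2 x → x · inv x ≡ I
·-inverseʳ (mat a b c d) det≡1 =
  mat-cong (trans (diag₁ a b c d) det≡1) (off₁ a b) (off₂ c d) (trans (diag₂ a b c d) det≡1)
  where
  diag₁ : ∀ a b c d → a * d + b * - c ≡ a * d - b * c
  diag₁ = solve-∀
  diag₂ : ∀ a b c d → c * - b + d * a ≡ a * d - b * c
  diag₂ = solve-∀
  off₁ : ∀ a b → a * - b + b * a ≡ 0ℤ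
  off₁ = solve-∀
  off₂ : ∀ c d → c * d + d * - c ≡ 0ℤ
  off₂ = solve-∀

det-· : ∀ x y → det (x · y) ≡ det x * det y
det-· (mat a₁ b₁ c₁ d₁) (mat a₂ b₂ c₂ d₂) = multiplicative a₁ b₁ c₁ d₁ a₂ b₂ c₂ d₂
  where
  multiplicative : ∀ a₁ b₁ c₁ d₁ a₂ b₂ c₂ d₂ →
    (a₁ * a₂ + b₁ * c₂) * (c₁ * b₂ + d₁ * d₂) - (a₁ * b₂ + b₁ * d₂) * (c₁ * a₂ + d₁ * c₂)
      ≡ (a₁ * d₁ - b₁ * c₁) * (a₂ * d₂ - b₂ * c₂)
  multiplicative = solve-∀

det-inv : ∀ x → det (inv x) ≡ det x
det-inv (mat a b c d) = adjugate a b c d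
  where
  adjugate : ∀ a b c d → d * a - - b * - c ≡ a * d - b * c
  adjugate = solve-∀

SL2-· : ∀ x y → SL2 x → SL2 y → SL2 (x · y)
SL2-· x y x∈ y∈ = trans (det-· x y) (cong₂ _*_ x∈ y∈)

SL2-inv : ∀ x → SL2 x → SL2 (inv x)
SL2-inv x x∈ = trans (det-inv x) x∈

SL2-^ : ∀ x n → SL2 x → SL2 (x ^^ n)
SL2-^ x zero    x∈ = refl
SL2-^ x (suc n) x∈ = SL2-· x (x ^^ n) x∈ (SL2-^ x n x∈)

module _ {p : ℕ} where

  c≈0 : ∀ x → Γ₀ p x → c x ≈ 0ℤ [mod p ]
  c≈0 x (_ , h) = mk≈ h

  Γ₀-I : Γ₀ p I
  Γ₀-I = refl , congruent (≈-refl {p} {0ℤ})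

  Γ₀-· : ∀ x y → Γ₀ p x → Γ₀ p y → Γ₀ p (x · y)
  Γ₀-· x y x∈ y∈ = SL2-· x y (proj₁ x∈) (proj₁ y∈) , congruent (begin
    c x * a y + d x * c y      ≈⟨ +-cong (*-congʳ (a y) (c≈0 x x∈)) (*-congˡ (d x) (c≈0 y y∈)) ⟩
    0ℤ * a y + d x * 0ℤ        ≡⟨ vanish (a y) (d x) ⟩
    0ℤ                         ∎)
    where
    open ≈-Reasoning p
    vanish : ∀ u v → 0ℤ * u + v * 0ℤ ≡ 0ℤ
    vanish = solve-∀

  Γ₀-inv : ∀ x → Γ₀ p x → Γ₀ p (inv x)
  Γ₀-inv x x∈ = SL2-inv x (proj₁ x∈) , congruent (-‿cong (c≈0 x x∈))

  Γ₀-^ : ∀ x n → Γ₀ p x → Γ₀ p (x ^^ n)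
  Γ₀-^ x zero    x∈ = Γ₀-I
  Γ₀-^ x (suc n) x∈ = Γ₀-· x (x ^^ n) x∈ (Γ₀-^ x n x∈)

  a-· : ∀ x y → Γ₀ p y → a (x · y) ≈ a x * a y [mod p ]
  a-· x y y∈ = begin
    a x * a y + b x * c y      ≈⟨ +-congˡ (a x * a y) (*-congˡ (b x) (c≈0 y y∈)) ⟩
    a x * a y + b x * 0ℤ       ≡⟨ vanish (a x * a y) (b x) ⟩
    a x * a y                  ∎
    where
    open ≈-Reasoning p
    vanish : ∀ u v → u + v * 0ℤ ≡ u
    vanish = solve-∀

  d-· : ∀ x y → Γ₀ p x → d (x · y) ≈ d x * d y [mod p ]
  d-· x y x∈ = begin
    c x * b y + d x * d y      ≈⟨ +-cong (*-congʳ (b y) (c≈0 x x∈)) ≈-refl ⟩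
    0ℤ * b y + d x * d y       ≡⟨ vanish (b y) (d x * d y) ⟩
    d x * d y                  ∎
    where
    open ≈-Reasoning p
    vanish : ∀ u v → 0ℤ * u + v ≡ v
    vanish = solve-∀

  a*d≈1 : ∀ x → Γ₀ p x → a x * d x ≈ 1ℤ [mod p ]
  a*d≈1 x x∈ = begin
    a x * d x                          ≡⟨ split (a x) (b x) (c x) (d x) ⟩
    (a x * d x - b x * c x) + b x * c x ≈⟨ +-cong (≈-reflexive (proj₁ x∈)) (*-congˡ (b x) (c≈0 x x∈)) ⟩
    1ℤ + b x * 0ℤ                      ≡⟨ vanish (b x) ⟩
    1ℤ                                 ∎
    where
    open ≈-Reasoning p
    split : ∀ a b c d → a * d ≡ (a * d - b * c) + b * c
    split = solve-∀
    vanish : ∀ u → 1ℤ + u * 0ℤ ≡ 1ℤ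
    vanish = solve-∀

  a-^ : ∀ x n → Γ₀ p x → a (x ^^ n) ≈ a x ^ n [mod p ]
  a-^ x zero    x∈ = ≈-refl
  a-^ x (suc n) x∈ = ≈-trans (a-· x (x ^^ n) (Γ₀-^ x n x∈)) (*-congˡ (a x) (a-^ x n x∈))

  a-conj : ∀ γ h → Γ₀ p γ → Γ₀ p h → a (γ · h · inv γ) ≈ a h [mod p ]
  a-conj γ h γ∈ h∈ = begin
    a (γ · h · inv γ)        ≈⟨ a-· (γ · h) (inv γ) (Γ₀-inv γ γ∈) ⟩
    a (γ · h) * d γ          ≈⟨ *-congʳ (d γ) (a-· γ h h∈) ⟩
    (a γ * a h) * d γ        ≡⟨ regroup (a γ) (a h) (d γ) ⟩
    a h * (a γ * d γ)        ≈⟨ *-congˡ (a h) (a*d≈1 γ γ∈) ⟩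
    a h * 1ℤ                 ≡⟨ ℤₚ.*-identityʳ (a h) ⟩
    a h                      ∎
    where
    open ≈-Reasoning p
    regroup : ∀ x y z → (x * y) * z ≡ y * (x * z)
    regroup = solve-∀

  d≈a⁻¹ : ∀ x {u} → Γ₀ p x → a x * u ≈ 1ℤ [mod p ] → d x ≈ u [mod p ]
  d≈a⁻¹ x {u} x∈ au≈1 = begin
    d x                  ≡⟨ ℤₚ.*-identityʳ (d x) ⟨
    d x * 1ℤ             ≈⟨ *-congˡ (d x) au≈1 ⟨
    d x * (a x * u)      ≡⟨ regroup (d x) (a x) u ⟩
    (a x * d x) * u      ≈⟨ *-congʳ u (a*d≈1 x x∈) ⟩
    1ℤ * u               ≡⟨ ℤₚ.*-identityˡ u ⟩
    u                    ∎
    where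
    open ≈-Reasoning p
    regroup : ∀ x y z → x * (y * z) ≡ (y * x) * z
    regroup = solve-∀

  Γ₀-lift : ∀ {u v} → u * v ≈ 1ℤ [mod p ] → ∃ λ x → Γ₀ p x × a x ≡ u
  Γ₀-lift {u} {v} uv≈1 with divides q uv-1≡qp ← ≈⇒∣ uv≈1 =
    mat u q (+ p) v , (det≡1 , congruent p≈0) , refl
    where
    cancel : ∀ w → w - (w - 1ℤ) ≡ 1ℤ
    cancel = solve-∀
    det≡1 : u * v - q * + p ≡ 1ℤ
    det≡1 = trans (cong (λ z → u * v - z) (sym uv-1≡qp)) (cancel (u * v))
    p≈0 : + p ≈ 0ℤ [mod p ]
    p≈0 = ≈-trans (≈-reflexive (sym (ℤₚ.*-identityˡ (+ p)))) (*n≈0 1ℤ)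

-- The character ψ, computed modulo 2

∀ℙ? : {P : Parity → Set} → (∀ q → Dec (P q)) → Dec (∀ q → P q)
∀ℙ? P? with P? 0ℙ | P? 1ℙ
... | yes P0 | yes P1 = yes λ { 0ℙ → P0 ; 1ℙ → P1 }
... | no ¬P0 | _      = no λ P → ¬P0 (P 0ℙ)
... | _      | no ¬P1 = no λ P → ¬P1 (P 1ℙ)

record M₂ : Set where
  constructor mat₂
  field a b c d : Parity

_·₂_ : M₂ → M₂ → M₂
mat₂ a₁ b₁ c₁ d₁ ·₂ mat₂ a₂ b₂ c₂ d₂ =
  mat₂ ((a₁ ℙ.* a₂) ℙ.+ (b₁ ℙ.* c₂)) ((a₁ ℙ.* b₂) ℙ.+ (b₁ ℙ.* d₂))
       ((c₁ ℙ.* a₂) ℙ.+ (d₁ ℙ.* c₂)) ((c₁ ℙ.* b₂) ℙ.+ (d₁ ℙ.* d₂))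

det₂ : M₂ → Parity
det₂ (mat₂ a b c d) = (a ℙ.* d) ℙ.+ (b ℙ.* c)

-- ψ reduced mod 2, with values written additively (1ℙ stands for -1).
ψ₂ : M₂ → Parity
ψ₂ (mat₂ a b 0ℙ d) = b
ψ₂ (mat₂ a b 1ℙ d) = (a ℙ.+ d) ℙ.+ 1ℙ

∀M₂? : {P : M₂ → Set} → (∀ x → Dec (P x)) → Dec (∀ x → P x)
∀M₂? P? = map′ (λ h x → h (M₂.a x) (M₂.b x) (M₂.c x) (M₂.d x)) (λ h a b c d → h (mat₂ a b c d))
               (∀ℙ? λ a → ∀ℙ? λ b → ∀ℙ? λ c → ∀ℙ? λ d → P? (mat₂ a b c d))

ψ₂-· : ∀ x y → det₂ x ≡ 1ℙ → det₂ y ≡ 1ℙ → ψ₂ (x ·₂ y) ≡ ψ₂ x ℙ.+ ψ₂ y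
ψ₂-· = toWitness {a? = ∀M₂? λ x → ∀M₂? λ y →
  (det₂ x ℙₚ.≟ 1ℙ) →-dec (det₂ y ℙₚ.≟ 1ℙ) →-dec (ψ₂ (x ·₂ y) ℙₚ.≟ ψ₂ x ℙ.+ ψ₂ y)} _

reduce : M → M₂
reduce γ = mat₂ (parityℤ (a γ)) (parityℤ (b γ)) (parityℤ (c γ)) (parityℤ (d γ))

ψᵖ : M → Parity
ψᵖ γ = ψ₂ (reduce γ)

ψ≡-1^ψᵖ : ∀ γ → ψ γ ≡ -1^ ψᵖ γ
ψ≡-1^ψᵖ (mat a b c d) = select ∣ c ∣ sgn[a+d-1] (sgn≡-1^parity b)
  where
  sgn[a+d-1] : sgn (a + d - 1ℤ) ≡ -1^ ((parityℤ a ℙ.+ parityℤ d) ℙ.+ 1ℙ)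
  sgn[a+d-1] = trans (sgn≡-1^parity (a + d - 1ℤ))
                     (cong -1^_ (trans (parityℤ-+ (a + d) -1ℤ) (cong (ℙ._+ 1ℙ) (parityℤ-+ a d))))
  select : ∀ {X Y} n → X ≡ -1^ ((parityℤ a ℙ.+ parityℤ d) ℙ.+ 1ℙ) → Y ≡ -1^ parityℤ b →
           (if n % 2 ℕ.≡ᵇ 1 then X else Y) ≡ -1^ ψ₂ (mat₂ (parityℤ a) (parityℤ b) (parity n) (parityℤ d))
  select 0             _   Y≡ = Y≡
  select 1             X≡ _   = X≡
  select (suc (suc n)) X≡ Y≡ = select n X≡ Y≡

det₂-reduce : ∀ γ → SL2 γ → det₂ (reduce γ) ≡ 1ℙ
det₂-reduce (mat a b c d) det≡1 = begin
  (parityℤ a ℙ.* parityℤ d) ℙ.+ (parityℤ b ℙ.* parityℤ c)  ≡⟨ cong₂ ℙ._+_ (parityℤ-* a d) (parityℤ-* b c) ⟨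
  parityℤ (a * d) ℙ.+ parityℤ (b * c)                      ≡⟨ cong (parityℤ (a * d) ℙ.+_) (parityℤ-neg (b * c)) ⟨
  parityℤ (a * d) ℙ.+ parityℤ (- (b * c))                  ≡⟨ parityℤ-+ (a * d) (- (b * c)) ⟨
  parityℤ (a * d - b * c)                                  ≡⟨ cong parityℤ det≡1 ⟩
  1ℙ                                                       ∎
  where open ≡-Reasoning

reduce-· : ∀ x y → reduce (x · y) ≡ reduce x ·₂ reduce y
reduce-· (mat a₁ b₁ c₁ d₁) (mat a₂ b₂ c₂ d₂) =
  mat₂-cong (row a₁ a₂ b₁ c₂) (row a₁ b₂ b₁ d₂) (row c₁ a₂ d₁ c₂) (row c₁ b₂ d₁ d₂)
  where
  mat₂-cong : ∀ {a a′ b b′ c c′ d d′} → a ≡ a′ → b ≡ b′ → c ≡ c′ → d ≡ d′ → mat₂ a b c d ≡ mat₂ a′ b′ c′ d′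
  mat₂-cong refl refl refl refl = refl
  row : ∀ w x y z → parityℤ (w * x + y * z) ≡ (parityℤ w ℙ.* parityℤ x) ℙ.+ (parityℤ y ℙ.* parityℤ z)
  row w x y z = trans (parityℤ-+ (w * x) (y * z)) (cong₂ ℙ._+_ (parityℤ-* w x) (parityℤ-* y z))

ψᵖ-· : ∀ x y → SL2 x → SL2 y → ψᵖ (x · y) ≡ ψᵖ x ℙ.+ ψᵖ y
ψᵖ-· x y x∈ y∈ = trans (cong ψ₂ (reduce-· x y)) (ψ₂-· (reduce x) (reduce y) (det₂-reduce x x∈) (det₂-reduce y y∈))

ψᵖ-inv : ∀ x → ψᵖ (inv x) ≡ ψᵖ x
ψᵖ-inv (mat a b c d) rewrite parityℤ-neg b | parityℤ-neg c = swap (parityℤ a) (parityℤ c) (parityℤ d)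
  where
  swap : ∀ a c d → ψ₂ (mat₂ d (parityℤ b) c a) ≡ ψ₂ (mat₂ a (parityℤ b) c d)
  swap a 0ℙ d = refl
  swap a 1ℙ d = cong (ℙ._+ 1ℙ) (ℙₚ.+-comm d a)

ψᵖ-^ : ∀ x n → SL2 x → ψᵖ (x ^^ n) ≡ ψᵖ x ℙ.* parity n
ψᵖ-^ x zero    x∈ = sym (ℙₚ.*-zeroʳ (ψᵖ x))
ψᵖ-^ x (suc n) x∈ = begin
  ψᵖ (x · x ^^ n)                          ≡⟨ ψᵖ-· x (x ^^ n) x∈ (SL2-^ x n x∈) ⟩
  ψᵖ x ℙ.+ ψᵖ (x ^^ n)                     ≡⟨ cong (ψᵖ x ℙ.+_) (ψᵖ-^ x n x∈) ⟩
  ψᵖ x ℙ.+ (ψᵖ x ℙ.* parity n)             ≡⟨ cong (ℙ._+ (ψᵖ x ℙ.* parity n)) (ℙₚ.*-identityʳ (ψᵖ x)) ⟨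
  (ψᵖ x ℙ.* 1ℙ) ℙ.+ (ψᵖ x ℙ.* parity n)    ≡⟨ ℙₚ.*-distribˡ-+ (ψᵖ x) 1ℙ (parity n) ⟨
  ψᵖ x ℙ.* (1ℙ ℙ.+ parity n)               ≡⟨ cong (ψᵖ x ℙ.*_) (ℙₚ.+-homo-+ 1 n) ⟨
  ψᵖ x ℙ.* parity (suc n)                  ∎
  where open ≡-Reasoning

ψᵖ-conj : ∀ γ h → SL2 γ → SL2 h → ψᵖ (γ · h · inv γ) ≡ ψᵖ h
ψᵖ-conj γ h γ∈ h∈ = begin
  ψᵖ (γ · h · inv γ)                       ≡⟨ ψᵖ-· (γ · h) (inv γ) (SL2-· γ h γ∈ h∈) (SL2-inv γ γ∈) ⟩
  ψᵖ (γ · h) ℙ.+ ψᵖ (inv γ)                ≡⟨ cong₂ ℙ._+_ (ψᵖ-· γ h γ∈ h∈) (ψᵖ-inv γ) ⟩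
  (ψᵖ γ ℙ.+ ψᵖ h) ℙ.+ ψᵖ γ                 ≡⟨ cong (ℙ._+ ψᵖ γ) (ℙₚ.+-comm (ψᵖ γ) (ψᵖ h)) ⟩
  (ψᵖ h ℙ.+ ψᵖ γ) ℙ.+ ψᵖ γ                 ≡⟨ ℙₚ.+-assoc (ψᵖ h) (ψᵖ γ) (ψᵖ γ) ⟩
  ψᵖ h ℙ.+ (ψᵖ γ ℙ.+ ψᵖ γ)                 ≡⟨ cong (ψᵖ h ℙ.+_) (ℙₚ.p+p≡0ℙ (ψᵖ γ)) ⟩
  ψᵖ h ℙ.+ 0ℙ                              ≡⟨ ℙₚ.+-identityʳ (ψᵖ h) ⟩
  ψᵖ h                                     ∎
  where open ≡-Reasoning

-- Primitive roots

module _ {p : ℕ} (p-prime : Prime p) where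

  ≈0-product : ∀ {x y} → x * y ≈ 0ℤ [mod p ] → x ≈ 0ℤ [mod p ] ⊎ y ≈ 0ℤ [mod p ]
  ≈0-product {x} {y} xy≈0 with euclidsLemma ∣ x ∣ ∣ y ∣ p-prime (subst (p ℕ∣.∣_) (ℤₚ.abs-* x y) (ℤ∣.∣⇒∣ᵤ (≈0⇒∣ xy≈0)))
  ... | inj₁ p∣x = inj₁ (∣⇒≈0 (ℤ∣.∣ᵤ⇒∣ p∣x))
  ... | inj₂ p∣y = inj₂ (∣⇒≈0 (ℤ∣.∣ᵤ⇒∣ p∣y))

  *-cancelˡ-≈ : ∀ {x y z} → ¬ x ≈ 0ℤ [mod p ] → x * y ≈ x * z [mod p ] → y ≈ z [mod p ]
  *-cancelˡ-≈ {x} {y} {z} x≉0 xy≈xz =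
    [ (λ x≈0 → contradiction x≈0 x≉0) , x-y≈0⇒x≈y ]′ (≈0-product x[y-z]≈0)
    where
    factor : ∀ x y z → x * y - x * z ≡ x * (y - z)
    factor = solve-∀
    x[y-z]≈0 : x * (y - z) ≈ 0ℤ [mod p ]
    x[y-z]≈0 = ∣⇒≈0 (subst (+ p ℤ∣.∣_) (factor x y z) (≈⇒∣ xy≈xz))

module PrimitiveRoot {N : ℕ} (p-prime : Prime (suc N)) (2<p : 2 ℕ.< suc N)
                     {g : ℤ} (generates : Generates (suc N) g) where

  instance
    N≢0 : NonZero N
    N≢0 = ℕ.>-nonZero (ℕₚ.≤-trans (s≤s z≤n) (ℕ.s≤s⁻¹ 2<p))

  N-1 : ℕ
  N-1 = ℕ.pred N

  1<p : 1 ℕ.< suc N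
  1<p = ℕₚ.<-trans (ℕₚ.n<1+n 1) 2<p

  g≉0 : ¬ g ≈ 0ℤ [mod suc N ]
  g≉0 g≈0 with generates (+ 2) (ℕ∣.>⇒∤ 2<p)
  ... | zero  , 2≡1  = contradiction (<-≈⇒≡ 2<p 1<p (mk≈ 2≡1)) λ ()
  ... | suc e , 2≡gᵉ = contradiction (<-≈⇒≡ 2<p z<s 2≈0) λ ()
    where
    2≈0 : + 2 ≈ 0ℤ [mod suc N ]
    2≈0 = ≈-trans (mk≈ 2≡gᵉ) (≈-trans (*-congʳ (g ^ e) g≈0) (≈-reflexive (ℤₚ.*-zeroˡ (g ^ e))))

  g^≉0 : ∀ e → ¬ g ^ e ≈ 0ℤ [mod suc N ]
  g^≉0 zero    1≈0 = contradiction (<-≈⇒≡ 1<p z<s 1≈0) λ ()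
  g^≉0 (suc e) gᵉ⁺¹≈0 = [ g≉0 , g^≉0 e ]′ (≈0-product p-prime gᵉ⁺¹≈0)

  g^-cancel : ∀ {u v} → u ℕ.≤ v → g ^ u ≈ g ^ v [mod suc N ] → g ^ (v ℕ.∸ u) ≈ 1ℤ [mod suc N ]
  g^-cancel {u} {v} u≤v gᵘ≈gᵛ = *-cancelˡ-≈ p-prime (g^≉0 u) (begin
    g ^ u * g ^ (v ℕ.∸ u)      ≡⟨ ℤₚ.^-distribˡ-+-* g u (v ℕ.∸ u) ⟨
    g ^ (u ℕ.+ (v ℕ.∸ u))      ≡⟨ cong (g ^_) (ℕₚ.m+[n∸m]≡n u≤v) ⟩
    g ^ v                      ≈⟨ gᵘ≈gᵛ ⟨
    g ^ u                      ≡⟨ ℤₚ.*-identityʳ (g ^ u) ⟨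
    g ^ u * 1ℤ                 ∎)
    where open ≈-Reasoning (suc N)

  log : (r : Fin N) → ∃ λ e → + suc (toℕ r) ≈ g ^ e [mod suc N ]
  log r with e , r≡gᵉ ← generates (+ suc (toℕ r)) (ℕ∣.>⇒∤ (s≤s (Finₚ.toℕ<n r))) = e , mk≈ r≡gᵉ

  -- If g^d ≡ 1 with 0 < d < N, the exponents of the N units 1, …, N collide modulo d.
  g^d≈1⇒d≡0 : ∀ {d} → d ℕ.< N → g ^ d ≈ 1ℤ [mod suc N ] → d ≡ 0
  g^d≈1⇒d≡0 {zero}   _   _    = refl
  g^d≈1⇒d≡0 {suc d′} d<N gᵈ≈1
    with i , j , i<j , eᵢ≡eⱼ ← Finₚ.pigeonhole d<N (λ r → fromℕ< (m%n<n (proj₁ (log r)) (suc d′))) =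
    contradiction (ℕₚ.suc-injective (<-≈⇒≡ (s≤s (Finₚ.toℕ<n i)) (s≤s (Finₚ.toℕ<n j)) collision)) (ℕₚ.<⇒≢ i<j)
    where
    collision : + suc (toℕ i) ≈ + suc (toℕ j) [mod suc N ]
    collision = begin
      + suc (toℕ i)              ≈⟨ proj₂ (log i) ⟩
      g ^ proj₁ (log i)          ≈⟨ ^-reduce (suc d′) gᵈ≈1 (proj₁ (log i)) ⟩
      g ^ (proj₁ (log i) % suc d′)    ≡⟨ cong (g ^_) (Finₚ.fromℕ<-injective _ _ _ _ eᵢ≡eⱼ) ⟩
      g ^ (proj₁ (log j) % suc d′)    ≈⟨ ^-reduce (suc d′) gᵈ≈1 (proj₁ (log j)) ⟨
      g ^ proj₁ (log j)          ≈⟨ proj₂ (log j) ⟨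
      + suc (toℕ j)              ∎
      where open ≈-Reasoning (suc N)

  residue : ℕ → ℕ
  residue e = g ^ e %ℕ suc N

  residue≢0 : ∀ e → residue e ≢ 0
  residue≢0 e rₑ≡0 = g^≉0 e (≈-trans (≈-%ℕ (g ^ e)) (≈-reflexive (cong +_ rₑ≡0)))

  suc-pred-residue : ∀ e → suc (ℕ.pred (residue e)) ≡ residue e
  suc-pred-residue e = ℕₚ.suc-pred (residue e) {{ℕ.≢-nonZero (residue≢0 e)}}

  pred-residue<N : ∀ e → ℕ.pred (residue e) ℕ.< N
  pred-residue<N e = ℕₚ.≤-trans (ℕₚ.≤-reflexive (suc-pred-residue e)) (ℕ.s≤s⁻¹ (n%ℕd<d (g ^ e) (suc N)))

  same-pred-residue : ∀ {e f} → ℕ.pred (residue e) ≡ ℕ.pred (residue f) → g ^ e ≈ g ^ f [mod suc N ]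
  same-pred-residue {e} {f} eq = begin
    g ^ e                 ≈⟨ ≈-%ℕ (g ^ e) ⟩
    + residue e           ≡⟨ cong +_ (suc-pred-residue e) ⟨
    + suc (ℕ.pred (residue e))  ≡⟨ cong (λ r → + suc r) eq ⟩
    + suc (ℕ.pred (residue f))  ≡⟨ cong +_ (suc-pred-residue f) ⟩
    + residue f           ≈⟨ ≈-%ℕ (g ^ f) ⟨
    g ^ f                 ∎
    where open ≈-Reasoning (suc N)

  residue-index : Fin (suc N) → Fin N
  residue-index i = fromℕ< (pred-residue<N (toℕ i))

  -- Two of the N + 1 powers g^0, …, g^N have the same nonzero residue.
  g^d≈1-for-some-d≤N : ∃ λ d → 0 ℕ.< d × d ℕ.≤ N × g ^ d ≈ 1ℤ [mod suc N ]
  g^d≈1-for-some-d≤N = from-collision (Finₚ.pigeonhole (ℕₚ.n<1+n N) residue-index)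
    where
    from-collision : (∃₂ λ i j → i Fin.< j × residue-index i ≡ residue-index j) →
                     ∃ λ d → 0 ℕ.< d × d ℕ.≤ N × g ^ d ≈ 1ℤ [mod suc N ]
    from-collision (i , j , i<j , eq) =
      toℕ j ℕ.∸ toℕ i , ℕₚ.m<n⇒0<n∸m i<j , ℕₚ.≤-trans (ℕₚ.m∸n≤m (toℕ j) (toℕ i)) (ℕₚ.<⇒≤pred (Finₚ.toℕ<n j)) ,
      g^-cancel (ℕₚ.<⇒≤ i<j) (same-pred-residue {toℕ i} {toℕ j}
        (Finₚ.fromℕ<-injective (ℕ.pred (residue (toℕ i))) (ℕ.pred (residue (toℕ j)))
                                                   (pred-residue<N (toℕ i)) (pred-residue<N (toℕ j)) eq))

  g^N≈1 : g ^ N ≈ 1ℤ [mod suc N ]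
  g^N≈1 = order-N g^d≈1-for-some-d≤N
    where
    order-N : (∃ λ d → 0 ℕ.< d × d ℕ.≤ N × g ^ d ≈ 1ℤ [mod suc N ]) → g ^ N ≈ 1ℤ [mod suc N ]
    order-N (d , 0<d , d≤N , gᵈ≈1) with ℕₚ.m≤n⇒m<n∨m≡n d≤N
    ... | inj₁ d<N  = contradiction (g^d≈1⇒d≡0 d<N gᵈ≈1) (ℕₚ.>⇒≢ 0<d)
    ... | inj₂ refl = gᵈ≈1

  g^-injective-≤ : ∀ {u v} → u ℕ.≤ v → v ℕ.< N → g ^ u ≈ g ^ v [mod suc N ] → u ≡ v
  g^-injective-≤ {u} {v} u≤v v<N gᵘ≈gᵛ =
    ℕₚ.≤-antisym u≤v (ℕₚ.m∸n≡0⇒m≤n (g^d≈1⇒d≡0 (ℕₚ.≤-<-trans (ℕₚ.m∸n≤m v u) v<N) (g^-cancel u≤v gᵘ≈gᵛ)))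

  g^-injective : ∀ {i j} → g ^ i ≈ g ^ j [mod suc N ] → + i ≈ + j [mod N ]
  g^-injective {i} {j} gⁱ≈gʲ = begin
    + i          ≈⟨ ≈-% i ⟩
    + (i % N)    ≡⟨ cong +_ (reduced (ℕₚ.≤-total (i % N) (j % N))) ⟩
    + (j % N)    ≈⟨ ≈-% j ⟨
    + j          ∎
    where
    open ≈-Reasoning N
    gⁱ′≈gʲ′ : g ^ (i % N) ≈ g ^ (j % N) [mod suc N ]
    gⁱ′≈gʲ′ = ≈-trans (≈-sym (^-reduce N g^N≈1 i)) (≈-trans gⁱ≈gʲ (^-reduce N g^N≈1 j))
    reduced : i % N ℕ.≤ j % N ⊎ j % N ℕ.≤ i % N → i % N ≡ j % N
    reduced (inj₁ ≤) = g^-injective-≤ ≤ (m%n<n j N) gⁱ′≈gʲ′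
    reduced (inj₂ ≥) = sym (g^-injective-≤ ≥ (m%n<n i N) (≈-sym gⁱ′≈gʲ′))

  g^[e*N]≈1 : ∀ e → g ^ (e ℕ.* N) ≈ 1ℤ [mod suc N ]
  g^[e*N]≈1 e = begin
    g ^ (e ℕ.* N)        ≡⟨ cong (g ^_) (ℕₚ.*-comm e N) ⟩
    g ^ (N ℕ.* e)        ≡⟨ ℤₚ.^-*-assoc g N e ⟨
    (g ^ N) ^ e          ≈⟨ ^-cong e g^N≈1 ⟩
    1ℤ ^ e               ≡⟨ ℤₚ.^-zeroˡ e ⟩
    1ℤ                   ∎
    where open ≈-Reasoning (suc N)

  g^e*g^[e*N-1]≈1 : ∀ e → g ^ e * g ^ (e ℕ.* N-1) ≈ 1ℤ [mod suc N ]
  g^e*g^[e*N-1]≈1 e = begin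
    g ^ e * g ^ (e ℕ.* N-1)      ≡⟨ ℤₚ.^-distribˡ-+-* g e _ ⟨
    g ^ (e ℕ.+ e ℕ.* N-1)        ≡⟨ cong (g ^_) (ℕₚ.*-suc e N-1) ⟨
    g ^ (e ℕ.* suc N-1)          ≡⟨ cong (λ n → g ^ (e ℕ.* n)) (ℕₚ.suc-pred N) ⟩
    g ^ (e ℕ.* N)                ≈⟨ g^[e*N]≈1 e ⟩
    1ℤ                           ∎
    where open ≈-Reasoning (suc N)

  d≈g^[e*N-1] : ∀ γ e → Γ₀ (suc N) γ → a γ ≈ g ^ e [mod suc N ] → d γ ≈ g ^ (e ℕ.* N-1) [mod suc N ]
  d≈g^[e*N-1] γ e γ∈ aγ≈gᵉ = d≈a⁻¹ γ γ∈ (≈-trans (*-congʳ _ aγ≈gᵉ) (g^e*g^[e*N-1]≈1 e))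

-- Γ₂′(p) and the quotient Γ₀(p)/Γ₂′(p)

IsNormalSubgroupOf-resp-≐ : ∀ {H H′ G : M → Set} → H ≐ H′ → IsNormalSubgroupOf H G → IsNormalSubgroupOf H′ G
IsNormalSubgroupOf-resp-≐ (H⊆H′ , H′⊆H) (⊆G , I∈ , ·-closed , inv-closed′ , conj-closed) =
  (λ γ → ⊆G γ ∘ H′⊆H) , H⊆H′ I∈ , (λ γ δ γ∈ δ∈ → H⊆H′ (·-closed γ δ (H′⊆H γ∈) (H′⊆H δ∈))) ,
  (λ γ γ∈ → H⊆H′ (inv-closed′ γ (H′⊆H γ∈))) , (λ γ h γ∈ h∈ → H⊆H′ (conj-closed γ h γ∈ (H′⊆H h∈)))

QuotientCyclicOfOrder-resp-≐ : ∀ {G H H′ : M → Set} {n} →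
                               H ≐ H′ → QuotientCyclicOfOrder G H n → QuotientCyclicOfOrder G H′ n
QuotientCyclicOfOrder-resp-≐ (H⊆H′ , H′⊆H) (x , x∈ , coset , order) =
  x , x∈ , (λ γ γ∈ → let i , r∈ = coset γ γ∈ in i , H⊆H′ r∈) ,
  λ m → proj₁ (order m) ∘ H′⊆H , H⊆H′ ∘ proj₂ (order m)

coset-parity : ∀ ε σ κ e q → ε ℙ.+ (σ ℙ.* κ) ≡ 1ℙ →
               (σ ℙ.* (e ℙ.+ (((σ ℙ.* e) ℙ.+ q) ℙ.* κ))) ℙ.+ q ≡ ε ℙ.* ((σ ℙ.* e) ℙ.+ q)
coset-parity = toWitness {a? = ∀ℙ? λ ε → ∀ℙ? λ σ → ∀ℙ? λ κ → ∀ℙ? λ e → ∀ℙ? λ q →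
  (ε ℙ.+ (σ ℙ.* κ) ℙₚ.≟ 1ℙ) →-dec
  ((σ ℙ.* (e ℙ.+ (((σ ℙ.* e) ℙ.+ q) ℙ.* κ))) ℙ.+ q ℙₚ.≟ ε ℙ.* ((σ ℙ.* e) ℙ.+ q))} _

order-parity : ∀ ε σ κ n → ε ℙ.+ (σ ℙ.* κ) ≡ 1ℙ → σ ℙ.* (n ℙ.* κ) ≡ ε ℙ.* n → n ≡ 0ℙ
order-parity = toWitness {a? = ∀ℙ? λ ε → ∀ℙ? λ σ → ∀ℙ? λ κ → ∀ℙ? λ n →
  (ε ℙ.+ (σ ℙ.* κ) ℙₚ.≟ 1ℙ) →-dec (σ ℙ.* (n ℙ.* κ) ℙₚ.≟ ε ℙ.* n) →-dec (n ℙₚ.≟ 0ℙ)} _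

module Γ₀/Γ₂′ {N : ℕ} (p-prime : Prime (suc N)) (2<p : 2 ℕ.< suc N) {g : ℤ} (generates : Generates (suc N) g)
               (k : ℕ) (2k∣N : 2 ℕ.* k ℕ∣.∣ N) where

  open PrimitiveRoot p-prime 2<p generates

  p : ℕ
  p = suc N

  g̃-lift : ∃ λ x → Γ₀ p x × a x ≡ g
  g̃-lift = Γ₀-lift (≈-trans (≈-reflexive (cong (g ^_) (ℕₚ.suc-pred N))) g^N≈1)

  g̃ : M
  g̃ = proj₁ g̃-lift

  g̃∈Γ₀ : Γ₀ p g̃
  g̃∈Γ₀ = proj₁ (proj₂ g̃-lift)

  a-g̃≈g : a g̃ ≈ g [mod p ]
  a-g̃≈g = ≈-reflexive (proj₂ (proj₂ g̃-lift))

  T : M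
  T = mat 1ℤ 1ℤ 0ℤ 1ℤ

  lift-g-with-ψᵖ : ∀ σ → ∃ λ x → Γ₀ p x × a x ≈ g [mod p ] × ψᵖ x ≡ σ
  lift-g-with-ψᵖ σ = pick (ψᵖ g̃ ℙₚ.≟ σ)
    where
    T∈Γ₀ : Γ₀ p T
    T∈Γ₀ = refl , congruent (≈-refl {p} {0ℤ})
    flip : ∀ {q σ} → q ≢ σ → q ℙ.+ 1ℙ ≡ σ
    flip {0ℙ} {0ℙ} q≢σ = contradiction refl q≢σ
    flip {0ℙ} {1ℙ} _   = refl
    flip {1ℙ} {0ℙ} _   = refl
    flip {1ℙ} {1ℙ} q≢σ = contradiction refl q≢σ
    pick : Dec (ψᵖ g̃ ≡ σ) → ∃ λ x → Γ₀ p x × a x ≈ g [mod p ] × ψᵖ x ≡ σ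
    pick (yes ψᵖg̃≡σ) = g̃ , g̃∈Γ₀ , a-g̃≈g , ψᵖg̃≡σ
    pick (no  ψᵖg̃≢σ) =
      g̃ · T , Γ₀-· g̃ T g̃∈Γ₀ T∈Γ₀ ,
      ≈-trans (a-· g̃ T T∈Γ₀) (≈-trans (≈-reflexive (ℤₚ.*-identityʳ (a g̃))) a-g̃≈g) ,
      trans (ψᵖ-· g̃ T (proj₁ g̃∈Γ₀) refl) (flip ψᵖg̃≢σ)

  a-^≈g^ : ∀ {x} n → Γ₀ p x → a x ≈ g [mod p ] → a (x ^^ n) ≈ g ^ n [mod p ]
  a-^≈g^ {x} n x∈ ax≈g = ≈-trans (a-^ x n x∈) (^-cong n ax≈g)

  g^[n*k]*g^[m*k] : ∀ n m → g ^ (n ℕ.* k) * g ^ (m ℕ.* k) ≡ g ^ ((n ℕ.+ m) ℕ.* k)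
  g^[n*k]*g^[m*k] n m =
    trans (sym (ℤₚ.^-distribˡ-+-* g (n ℕ.* k) (m ℕ.* k))) (cong (g ^_) (sym (ℕₚ.*-distribʳ-+ k n m)))

  d≈g^[n*N-1*k] : ∀ γ n → Γ₀ p γ → a γ ≈ g ^ (n ℕ.* k) [mod p ] → d γ ≈ g ^ ((n ℕ.* N-1) ℕ.* k) [mod p ]
  d≈g^[n*N-1*k] γ n γ∈ aγ≈ =
    ≈-trans (d≈g^[e*N-1] γ (n ℕ.* k) γ∈ aγ≈) (≈-reflexive (cong (g ^_) (swap n k N-1)))
    where
    swap : ∀ n k m → (n ℕ.* k) ℕ.* m ≡ (n ℕ.* m) ℕ.* k
    swap = ℕ-solve-∀

  a∈⟨gᵏ⟩ : M → Set
  a∈⟨gᵏ⟩ γ = ∃ λ n → a γ ≈ g ^ (n ℕ.* k) [mod p ]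

  Γ₂⇒Γ₀∩a∈⟨gᵏ⟩ : ∀ {γ} → Γ₂ p g k γ → Γ₀ p γ × a∈⟨gᵏ⟩ γ
  Γ₂⇒Γ₀∩a∈⟨gᵏ⟩ (gen (inj₁ (γ∈ , a≡1 , _))) = γ∈ , 0 , mk≈ a≡1
  Γ₂⇒Γ₀∩a∈⟨gᵏ⟩ (gen (inj₂ (γ∈ , a≡gᵏ))) =
    γ∈ , 1 , ≈-trans (mk≈ a≡gᵏ) (≈-reflexive (cong (g ^_) (sym (ℕₚ.*-identityˡ k))))
  Γ₂⇒Γ₀∩a∈⟨gᵏ⟩ one = Γ₀-I , 0 , ≈-refl
  Γ₂⇒Γ₀∩a∈⟨gᵏ⟩ (mul {γ} {δ} γ∈ δ∈) =
    let γ∈Γ₀ , n , aγ≈ = Γ₂⇒Γ₀∩a∈⟨gᵏ⟩ γ∈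
        δ∈Γ₀ , m , aδ≈ = Γ₂⇒Γ₀∩a∈⟨gᵏ⟩ δ∈
    in Γ₀-· γ δ γ∈Γ₀ δ∈Γ₀ , n ℕ.+ m ,
       ≈-trans (a-· γ δ δ∈Γ₀) (≈-trans (*-cong aγ≈ aδ≈) (≈-reflexive (g^[n*k]*g^[m*k] n m)))
  Γ₂⇒Γ₀∩a∈⟨gᵏ⟩ (inv-closed {γ} γ∈) =
    let γ∈Γ₀ , n , aγ≈ = Γ₂⇒Γ₀∩a∈⟨gᵏ⟩ γ∈
    in Γ₀-inv γ γ∈Γ₀ , n ℕ.* N-1 , d≈g^[n*N-1*k] γ n γ∈Γ₀ aγ≈

  -- γ = yⁿ · (y⁻ⁿ γ) with y = g̃ᵏ a generator of Γ₂ and y⁻ⁿ γ ∈ Γ₁.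
  Γ₀∩a∈⟨gᵏ⟩⇒Γ₂ : ∀ {γ} → Γ₀ p γ → a∈⟨gᵏ⟩ γ → Γ₂ p g k γ
  Γ₀∩a∈⟨gᵏ⟩⇒Γ₂ {γ} γ∈ (n , aγ≈) =
    subst (Γ₂ p g k) yⁿ·r≡γ (mul {γ = yⁿ} (yⁿ∈Γ₂ n) (gen {γ = r} (inj₁ (r∈Γ₀ , congruent a-r≈1 , congruent d-r≈1))))
    where
    y : M
    y = g̃ ^^ k
    y∈Γ₀ : Γ₀ p y
    y∈Γ₀ = Γ₀-^ g̃ k g̃∈Γ₀
    yⁿ∈Γ₂ : ∀ n → Γ₂ p g k (y ^^ n)
    yⁿ∈Γ₂ zero    = one
    yⁿ∈Γ₂ (suc n) = mul {γ = y} (gen {γ = y} (inj₂ (y∈Γ₀ , congruent (a-^≈g^ k g̃∈Γ₀ a-g̃≈g)))) (yⁿ∈Γ₂ n)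
    yⁿ : M
    yⁿ = y ^^ n
    yⁿ∈Γ₀ : Γ₀ p yⁿ
    yⁿ∈Γ₀ = Γ₀-^ y n y∈Γ₀
    a-yⁿ≈aγ : a yⁿ ≈ a γ [mod p ]
    a-yⁿ≈aγ = ≈-trans (a-^ y n y∈Γ₀) (≈-trans (^-cong n (a-^≈g^ k g̃∈Γ₀ a-g̃≈g))
                (≈-trans (≈-reflexive (trans (ℤₚ.^-*-assoc g k n) (cong (g ^_) (ℕₚ.*-comm k n)))) (≈-sym aγ≈)))
    r : M
    r = inv yⁿ · γ
    r∈Γ₀ : Γ₀ p r
    r∈Γ₀ = Γ₀-· (inv yⁿ) γ (Γ₀-inv yⁿ yⁿ∈Γ₀) γ∈
    a-r≈1 : a r ≈ 1ℤ [mod p ]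
    a-r≈1 = ≈-trans (a-· (inv yⁿ) γ γ∈) (≈-trans (*-congˡ (d yⁿ) (≈-sym a-yⁿ≈aγ))
              (≈-trans (≈-reflexive (ℤₚ.*-comm (d yⁿ) (a yⁿ))) (a*d≈1 yⁿ yⁿ∈Γ₀)))
    d-r≈1 : d r ≈ 1ℤ [mod p ]
    d-r≈1 = ≈-trans (d-· (inv yⁿ) γ (Γ₀-inv yⁿ yⁿ∈Γ₀)) (≈-trans (*-congʳ (d γ) a-yⁿ≈aγ) (a*d≈1 γ γ∈))
    yⁿ·r≡γ : yⁿ · r ≡ γ
    yⁿ·r≡γ = trans (sym (·-assoc yⁿ (inv yⁿ) γ)) (trans (cong (_· γ) (·-inverseʳ yⁿ (proj₁ yⁿ∈Γ₀))) (·-identityˡ γ))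

  -- ε = 1ℙ gives the kernel of ψχ on Γ₂(p), ε = 0ℙ the kernel of ψ.
  Γ₂ᵋ : Parity → M → Set
  Γ₂ᵋ ε γ = Γ₀ p γ × ∃ λ n → a γ ≈ g ^ (n ℕ.* k) [mod p ] × ψᵖ γ ≡ ε ℙ.* parity n

  parity-N-1 : parity N-1 ≡ 1ℙ
  parity-N-1 = begin
    parity N-1               ≡⟨ ℙₚ.suc-homo-⁻¹ N-1 ⟨
    parity (suc N-1) ℙ.⁻¹    ≡⟨ cong (λ n → parity n ℙ.⁻¹) (ℕₚ.suc-pred N) ⟩
    parity N ℙ.⁻¹            ≡⟨ cong ℙ._⁻¹ (even⇒parity≡0ℙ (ℕ∣.∣-trans (ℕ∣.m∣m*n k) 2k∣N)) ⟩
    1ℙ                       ∎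
    where open ≡-Reasoning

  Γ₂ᵋ-normal : ∀ ε → IsNormalSubgroupOf (Γ₂ᵋ ε) (Γ₀ p)
  Γ₂ᵋ-normal ε = (λ _ → proj₁) , (Γ₀-I , 0 , ≈-refl , sym (ℙₚ.*-zeroʳ ε)) , ·-closed , inv-closed′ , conj-closed
    where
    ·-closed : ∀ γ δ → Γ₂ᵋ ε γ → Γ₂ᵋ ε δ → Γ₂ᵋ ε (γ · δ)
    ·-closed γ δ (γ∈ , n , aγ≈ , ψγ≡) (δ∈ , m , aδ≈ , ψδ≡) =
      Γ₀-· γ δ γ∈ δ∈ , n ℕ.+ m ,
      ≈-trans (a-· γ δ δ∈) (≈-trans (*-cong aγ≈ aδ≈) (≈-reflexive (g^[n*k]*g^[m*k] n m))) ,
      (begin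
        ψᵖ (γ · δ)                                ≡⟨ ψᵖ-· γ δ (proj₁ γ∈) (proj₁ δ∈) ⟩
        ψᵖ γ ℙ.+ ψᵖ δ                             ≡⟨ cong₂ ℙ._+_ ψγ≡ ψδ≡ ⟩
        (ε ℙ.* parity n) ℙ.+ (ε ℙ.* parity m)     ≡⟨ ℙₚ.*-distribˡ-+ ε (parity n) (parity m) ⟨
        ε ℙ.* (parity n ℙ.+ parity m)             ≡⟨ cong (ε ℙ.*_) (ℙₚ.+-homo-+ n m) ⟨
        ε ℙ.* parity (n ℕ.+ m)                    ∎)
      where open ≡-Reasoning
    inv-closed′ : ∀ γ → Γ₂ᵋ ε γ → Γ₂ᵋ ε (inv γ)
    inv-closed′ γ (γ∈ , n , aγ≈ , ψγ≡) =
      Γ₀-inv γ γ∈ , n ℕ.* N-1 , d≈g^[n*N-1*k] γ n γ∈ aγ≈ ,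
      (begin
        ψᵖ (inv γ)                           ≡⟨ ψᵖ-inv γ ⟩
        ψᵖ γ                                 ≡⟨ ψγ≡ ⟩
        ε ℙ.* parity n                       ≡⟨ cong (ε ℙ.*_) (ℙₚ.*-identityʳ (parity n)) ⟨
        ε ℙ.* (parity n ℙ.* 1ℙ)              ≡⟨ cong (λ q → ε ℙ.* (parity n ℙ.* q)) parity-N-1 ⟨
        ε ℙ.* (parity n ℙ.* parity N-1)      ≡⟨ cong (ε ℙ.*_) (ℙₚ.*-homo-* n N-1) ⟨
        ε ℙ.* parity (n ℕ.* N-1)             ∎)
      where open ≡-Reasoning
    conj-closed : ∀ γ h → Γ₀ p γ → Γ₂ᵋ ε h → Γ₂ᵋ ε (γ · h · inv γ)
    conj-closed γ h γ∈ (h∈ , n , ah≈ , ψh≡) =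
      Γ₀-· (γ · h) (inv γ) (Γ₀-· γ h γ∈ h∈) (Γ₀-inv γ γ∈) , n , ≈-trans (a-conj γ h γ∈ h∈) ah≈ ,
      trans (ψᵖ-conj γ h (proj₁ γ∈) (proj₁ h∈)) ψh≡

  a-unit : ∀ γ → Γ₀ p γ → ¬ (+ p ∣ᵤ a γ)
  a-unit γ γ∈ p∣a = contradiction (<-≈⇒≡ 1<p z<s 1≈0) λ ()
    where
    1≈0 : 1ℤ ≈ 0ℤ [mod p ]
    1≈0 = ≈-trans (≈-sym (a*d≈1 γ γ∈))
                  (≈-trans (*-congʳ (d γ) (∣⇒≈0 {x = a γ} (ℤ∣.∣ᵤ⇒∣ p∣a))) (≈-reflexive (ℤₚ.*-zeroˡ (d γ))))

  bitℕ : Parity → ℕ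
  bitℕ 0ℙ = 0
  bitℕ 1ℙ = 1

  parity-bitℕ : ∀ q → parity (bitℕ q) ≡ q
  parity-bitℕ 0ℙ = refl
  parity-bitℕ 1ℙ = refl

  module _ (ε σ : Parity) (balanced : ε ℙ.+ (σ ℙ.* parity k) ≡ 1ℙ) where

    x : M
    x = proj₁ (lift-g-with-ψᵖ σ)

    x∈Γ₀ : Γ₀ p x
    x∈Γ₀ = proj₁ (proj₂ (lift-g-with-ψᵖ σ))

    a-x≈g : a x ≈ g [mod p ]
    a-x≈g = proj₁ (proj₂ (proj₂ (lift-g-with-ψᵖ σ)))

    ψᵖ-x≡σ : ψᵖ x ≡ σ
    ψᵖ-x≡σ = proj₂ (proj₂ (proj₂ (lift-g-with-ψᵖ σ)))

    a-x^ : ∀ n → a (x ^^ n) ≈ g ^ n [mod p ]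
    a-x^ n = a-^≈g^ n x∈Γ₀ a-x≈g

    ψᵖ-x^ : ∀ n → ψᵖ (x ^^ n) ≡ σ ℙ.* parity n
    ψᵖ-x^ n = trans (ψᵖ-^ x n (proj₁ x∈Γ₀)) (cong (ℙ._* parity n) ψᵖ-x≡σ)

    -- The exponent i = e + t k with a γ ≡ gᵉ, where the parity of t ∈ {0, 1} is chosen to fix ψ.
    coset-representative′ : ∀ γ e → Γ₀ p γ → a γ ≈ g ^ e [mod p ] → ∃ λ i → Γ₂ᵋ ε (inv (x ^^ i) · γ)
    coset-representative′ γ e γ∈ aγ≈gᵉ =
      i , Γ₀-· (inv (x ^^ i)) γ (Γ₀-inv (x ^^ i) (Γ₀-^ x i x∈Γ₀)) γ∈ , t ℕ.* N-1 , a-r≈ , ψᵖ-r≡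
      where
      q = (σ ℙ.* parity e) ℙ.+ ψᵖ γ
      t = bitℕ q
      i = e ℕ.+ t ℕ.* k
      exponent : ∀ e t k m → (e ℕ.+ t ℕ.* k) ℕ.* m ℕ.+ e ≡ e ℕ.* suc m ℕ.+ (t ℕ.* m) ℕ.* k
      exponent = ℕ-solve-∀
      a-r≈ : a (inv (x ^^ i) · γ) ≈ g ^ ((t ℕ.* N-1) ℕ.* k) [mod p ]
      a-r≈ = begin
        a (inv (x ^^ i) · γ)                              ≈⟨ a-· (inv (x ^^ i)) γ γ∈ ⟩
        d (x ^^ i) * a γ                                  ≈⟨ *-cong (d≈g^[e*N-1] (x ^^ i) i (Γ₀-^ x i x∈Γ₀) (a-x^ i)) aγ≈gᵉ ⟩
        g ^ (i ℕ.* N-1) * g ^ e                           ≡⟨ ℤₚ.^-distribˡ-+-* g (i ℕ.* N-1) e ⟨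
        g ^ (i ℕ.* N-1 ℕ.+ e)                             ≡⟨ cong (g ^_) (exponent e t k N-1) ⟩
        g ^ (e ℕ.* suc N-1 ℕ.+ (t ℕ.* N-1) ℕ.* k)         ≡⟨ cong (λ n → g ^ (e ℕ.* n ℕ.+ (t ℕ.* N-1) ℕ.* k)) (ℕₚ.suc-pred N) ⟩
        g ^ (e ℕ.* N ℕ.+ (t ℕ.* N-1) ℕ.* k)               ≡⟨ ℤₚ.^-distribˡ-+-* g (e ℕ.* N) _ ⟩
        g ^ (e ℕ.* N) * g ^ ((t ℕ.* N-1) ℕ.* k)           ≈⟨ *-congʳ _ (g^[e*N]≈1 e) ⟩
        1ℤ * g ^ ((t ℕ.* N-1) ℕ.* k)                      ≡⟨ ℤₚ.*-identityˡ _ ⟩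
        g ^ ((t ℕ.* N-1) ℕ.* k)                           ∎
        where open ≈-Reasoning p
      ψᵖ-r≡ : ψᵖ (inv (x ^^ i) · γ) ≡ ε ℙ.* parity (t ℕ.* N-1)
      ψᵖ-r≡ = begin
        ψᵖ (inv (x ^^ i) · γ)                             ≡⟨ ψᵖ-· (inv (x ^^ i)) γ (SL2-inv (x ^^ i) (SL2-^ x i (proj₁ x∈Γ₀))) (proj₁ γ∈) ⟩
        ψᵖ (inv (x ^^ i)) ℙ.+ ψᵖ γ                        ≡⟨ cong (ℙ._+ ψᵖ γ) (trans (ψᵖ-inv (x ^^ i)) (ψᵖ-x^ i)) ⟩
        (σ ℙ.* parity i) ℙ.+ ψᵖ γ                         ≡⟨ cong (λ π → (σ ℙ.* π) ℙ.+ ψᵖ γ) parity-i ⟩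
        (σ ℙ.* (parity e ℙ.+ (q ℙ.* parity k))) ℙ.+ ψᵖ γ  ≡⟨ coset-parity ε σ (parity k) (parity e) (ψᵖ γ) balanced ⟩
        ε ℙ.* q                                           ≡⟨ cong (ε ℙ.*_) parity-t*N-1 ⟨
        ε ℙ.* parity (t ℕ.* N-1)                          ∎
        where
        open ≡-Reasoning
        parity-i : parity i ≡ parity e ℙ.+ (q ℙ.* parity k)
        parity-i = trans (ℙₚ.+-homo-+ e (t ℕ.* k))
                         (cong (parity e ℙ.+_) (trans (ℙₚ.*-homo-* t k) (cong (ℙ._* parity k) (parity-bitℕ q))))
        parity-t*N-1 : parity (t ℕ.* N-1) ≡ q
        parity-t*N-1 =
          trans (ℙₚ.*-homo-* t N-1) (trans (cong₂ ℙ._*_ (parity-bitℕ q) parity-N-1) (ℙₚ.*-identityʳ q))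

    coset-representative : ∀ γ → Γ₀ p γ → ∃ λ i → Γ₂ᵋ ε (inv (x ^^ i) · γ)
    coset-representative γ γ∈ =
      let e , aγ≡gᵉ = generates (a γ) (a-unit γ γ∈) in coset-representative′ γ e γ∈ (mk≈ aγ≡gᵉ)

    x^m∈Γ₂ᵋ⇒2k∣m : ∀ m → Γ₂ᵋ ε (x ^^ m) → 2 ℕ.* k ℕ∣.∣ m
    x^m∈Γ₂ᵋ⇒2k∣m m (_ , n , a≈ , ψᵖ≡) = ℤ∣.∣⇒∣ᵤ (≈0⇒∣ (≈-trans m≈nk (∣⇒≈0 (ℤ∣.∣ᵤ⇒∣ 2k∣nk))))
      where
      m≈nk : + m ≈ + (n ℕ.* k) [mod 2 ℕ.* k ]
      m≈nk = ≈-weaken 2k∣N (g^-injective (≈-trans (≈-sym (a-x^ m)) a≈))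
      parity-m : parity m ≡ parity n ℙ.* parity k
      parity-m = trans (≈[mod2]⇒parity≡ (≈-weaken (ℕ∣.m∣m*n k) m≈nk)) (ℙₚ.*-homo-* n k)
      n-even : parity n ≡ 0ℙ
      n-even = order-parity ε σ (parity k) (parity n) balanced
                 (trans (cong (σ ℙ.*_) (sym parity-m)) (trans (sym (ψᵖ-x^ m)) ψᵖ≡))
      2k∣nk : 2 ℕ.* k ℕ∣.∣ n ℕ.* k
      2k∣nk = ℕ∣.*-monoˡ-∣ k (parity≡0ℙ⇒even {n} n-even)

    2k∣m⇒x^m∈Γ₂ᵋ : ∀ m → 2 ℕ.* k ℕ∣.∣ m → Γ₂ᵋ ε (x ^^ m)
    2k∣m⇒x^m∈Γ₂ᵋ m 2k∣m@(ℕ∣.divides j m≡j*2k) =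
      Γ₀-^ x m x∈Γ₀ , 2 ℕ.* j , ≈-trans (a-x^ m) (≈-reflexive (cong (g ^_) (trans m≡j*2k (regroup j k)))) , (begin
        ψᵖ (x ^^ m)               ≡⟨ ψᵖ-x^ m ⟩
        σ ℙ.* parity m            ≡⟨ cong (σ ℙ.*_) (even⇒parity≡0ℙ (ℕ∣.∣-trans (ℕ∣.m∣m*n k) 2k∣m)) ⟩
        σ ℙ.* 0ℙ                  ≡⟨ ℙₚ.*-zeroʳ σ ⟩
        0ℙ                        ≡⟨ ℙₚ.*-zeroʳ ε ⟨
        ε ℙ.* 0ℙ                  ≡⟨ cong (ε ℙ.*_) (even⇒parity≡0ℙ (ℕ∣.m∣m*n j)) ⟨
        ε ℙ.* parity (2 ℕ.* j)    ∎)
      where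
      open ≡-Reasoning
      regroup : ∀ j k → j ℕ.* (2 ℕ.* k) ≡ (2 ℕ.* j) ℕ.* k
      regroup = ℕ-solve-∀

    Γ₀/Γ₂ᵋ-cyclic : QuotientCyclicOfOrder (Γ₀ p) (Γ₂ᵋ ε) (2 ℕ.* k)
    Γ₀/Γ₂ᵋ-cyclic = x , x∈Γ₀ , coset-representative , λ m → x^m∈Γ₂ᵋ⇒2k∣m m , 2k∣m⇒x^m∈Γ₂ᵋ m

  Ker[ψχ] : M → Set
  Ker[ψχ] γ = Γ₂ p g k γ × ∃ λ (n : ℕ) → (a γ ≡ g ^ (n ℕ.* k) [mod p ]) × (ψ γ * sgn (+ n) ≡ 1ℤ)

  Ker[ψ] : M → Set
  Ker[ψ] γ = Γ₂ p g k γ × ψ γ ≡ 1ℤ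

  ψ*sgn≡1⇔ψᵖ≡parity : ∀ γ n → (ψ γ * sgn (+ n) ≡ 1ℤ) ⇔ (ψᵖ γ ≡ parity n)
  ψ*sgn≡1⇔ψᵖ≡parity γ n = mk⇔
    (λ eq → sum≡0⇒≡ (-1^≡1⇒0ℙ (trans (sym ψ*sgn≡-1^sum) eq)))
    (λ eq → trans ψ*sgn≡-1^sum (cong -1^_ (trans (cong (ℙ._+ parity n) eq) (ℙₚ.p+p≡0ℙ (parity n)))))
    where
    ψ*sgn≡-1^sum : ψ γ * sgn (+ n) ≡ -1^ (ψᵖ γ ℙ.+ parity n)
    ψ*sgn≡-1^sum = trans (cong₂ _*_ (ψ≡-1^ψᵖ γ) (sgn≡-1^parity (+ n))) (sym (-1^-+ (ψᵖ γ) (parity n)))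
    sum≡0⇒≡ : ∀ {q r} → q ℙ.+ r ≡ 0ℙ → q ≡ r
    sum≡0⇒≡ {0ℙ} {0ℙ} _ = refl
    sum≡0⇒≡ {1ℙ} {1ℙ} _ = refl

  Ker[ψχ]≐Γ₂ᵋ : Ker[ψχ] ≐ Γ₂ᵋ 1ℙ
  Ker[ψχ]≐Γ₂ᵋ =
    (λ { {γ} (γ∈ , n , a≡ , ψ*sgn≡1) →
         proj₁ (Γ₂⇒Γ₀∩a∈⟨gᵏ⟩ γ∈) , n , mk≈ a≡ , Equivalence.to (ψ*sgn≡1⇔ψᵖ≡parity γ n) ψ*sgn≡1 }) ,
    (λ { {γ} (γ∈ , n , a≈ , ψᵖ≡) →
         Γ₀∩a∈⟨gᵏ⟩⇒Γ₂ γ∈ (n , a≈) , n , congruent a≈ , Equivalence.from (ψ*sgn≡1⇔ψᵖ≡parity γ n) ψᵖ≡ })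

  Ker[ψ]≐Γ₂ᵋ : Ker[ψ] ≐ Γ₂ᵋ 0ℙ
  Ker[ψ]≐Γ₂ᵋ =
    (λ { {γ} (γ∈ , ψ≡1) →
         let γ∈Γ₀ , n , a≈ = Γ₂⇒Γ₀∩a∈⟨gᵏ⟩ γ∈ in γ∈Γ₀ , n , a≈ , -1^≡1⇒0ℙ (trans (sym (ψ≡-1^ψᵖ γ)) ψ≡1) }) ,
    (λ { {γ} (γ∈ , n , a≈ , ψᵖ≡0) → Γ₀∩a∈⟨gᵏ⟩⇒Γ₂ γ∈ (n , a≈) , trans (ψ≡-1^ψᵖ γ) (cong -1^_ ψᵖ≡0) })

  k-even⇒p≡1[mod4] : 2 ℕ∣.∣ k → p % 4 ≡ 1
  k-even⇒p≡1[mod4] 2∣k =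
    let ℕ∣.divides q N≡q*4 = ℕ∣.∣-trans (ℕ∣.*-monoʳ-∣ 2 2∣k) 2k∣N
    in trans (cong (λ n → suc n % 4) N≡q*4) ([m+kn]%n≡m%n 1 q 4)

  p≢1[mod4]⇒k-odd : (p % 4 ℕ.≡ᵇ 1) ≡ false → parity k ≡ 1ℙ
  p≢1[mod4]⇒k-odd p%4≢1 = odd (parity k) refl
    where
    odd : ∀ q → parity k ≡ q → parity k ≡ 1ℙ
    odd 1ℙ pk≡1 = pk≡1
    odd 0ℙ pk≡0 = contradiction (trans (sym (cong (ℕ._≡ᵇ 1) (k-even⇒p≡1[mod4] (parity≡0ℙ⇒even pk≡0)))) p%4≢1) λ ()

  Γ₂′≐Ker : ∀ {b} → (p % 4 ℕ.≡ᵇ 1) ≡ b → Γ₂′ p g k ≐ (λ γ → if b then Ker[ψχ] γ else Ker[ψ] γ)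
  Γ₂′≐Ker eq = subst (λ b → Γ₂′ p g k ≐ (λ γ → if b then Ker[ψχ] γ else Ker[ψ] γ)) eq ≐-refl

  -- ε is the twist of Γ₂′(p), σ the value of ψᵖ on the generator of the quotient.
  Γ₂′-twisted : ∃₂ λ ε σ → Γ₂′ p g k ≐ Γ₂ᵋ ε × ε ℙ.+ (σ ℙ.* parity k) ≡ 1ℙ
  Γ₂′-twisted = twist (p % 4 ℕ.≡ᵇ 1) refl
    where
    twist : ∀ b → (p % 4 ℕ.≡ᵇ 1) ≡ b → ∃₂ λ ε σ → Γ₂′ p g k ≐ Γ₂ᵋ ε × ε ℙ.+ (σ ℙ.* parity k) ≡ 1ℙ
    twist true  p%4≡1 = 1ℙ , 0ℙ , ≐-trans (Γ₂′≐Ker p%4≡1) Ker[ψχ]≐Γ₂ᵋ , refl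
    twist false p%4≢1 = 0ℙ , 1ℙ , ≐-trans (Γ₂′≐Ker p%4≢1) Ker[ψ]≐Γ₂ᵋ , p≢1[mod4]⇒k-odd p%4≢1

  Γ₂′-normal-with-cyclic-quotient :
    IsNormalSubgroupOf (Γ₂′ p g k) (Γ₀ p) × QuotientCyclicOfOrder (Γ₀ p) (Γ₂′ p g k) (2 ℕ.* k)
  Γ₂′-normal-with-cyclic-quotient =
    let ε , σ , Γ₂′≐Γ₂ᵋ , balanced = Γ₂′-twisted
    in IsNormalSubgroupOf-resp-≐ (≐-sym Γ₂′≐Γ₂ᵋ) (Γ₂ᵋ-normal ε) ,
       QuotientCyclicOfOrder-resp-≐ (≐-sym Γ₂′≐Γ₂ᵋ) (Γ₀/Γ₂ᵋ-cyclic ε σ balanced)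

lemma3p3 : (p : ℕ) → Prime p → 5 ℕ.≤ p → (g : ℤ) → IsOdd g → Generates p g →
           (k ℓ : ℕ) → k ℕ.* gcd (p ℕ.∸ 1) 12 ≡ p ℕ.∸ 1 → 2 ℕ.* ℓ ≡ gcd (p ℕ.∸ 1) 12 →
           IsNormalSubgroupOf (Γ₂′ p g k) (Γ₀ p)
           × QuotientCyclicOfOrder (Γ₀ p) (Γ₂′ p g k) (2 ℕ.* k)
lemma3p3 (suc N) p-prime (s≤s 4≤N) g _ generates k ℓ k*gcd≡N 2ℓ≡gcd =
  Γ₀/Γ₂′.Γ₂′-normal-with-cyclic-quotient p-prime 2<p generates k 2k∣N
  where
  2<p : 2 ℕ.< suc N
  2<p = ℕₚ.≤-trans (s≤s (s≤s (s≤s z≤n))) (s≤s 4≤N)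
  swap : ∀ k ℓ → k ℕ.* (2 ℕ.* ℓ) ≡ ℓ ℕ.* (2 ℕ.* k)
  swap = ℕ-solve-∀
  2k∣N : 2 ℕ.* k ℕ∣.∣ N
  2k∣N = ℕ∣.divides ℓ (trans (sym k*gcd≡N) (trans (cong (k ℕ.*_) (sym 2ℓ≡gcd)) (swap k ℓ)))
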